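{- Let $I=[\varnothing:b,i,a]$ be a High ICS of $[2]\times[n]$ with $i\ne n$ (so $1\le i<n$, $b+i+a=n$). Then $\mathrm{Row}^3(I)$ is a Low ICS, neither $\mathrm{Row}(I)$ nor $\mathrm{Row}^2(I)$ is High or Low, and: (a) if $a\ge3$, $\mathrm{Row}^3(I)=[b+3,i,a-3:\varnothing]$; (b) if $0<a<3$, $\mathrm{Row}^3(I)=[2-a,n-i,i-2+a:\varnothing]$; (c) if $a=0$ and $1<i<n$, $\mathrm{Row}^3(I)=[2,n-i,i-2:\varnothing]$, while if $a=0$ and $i=1$, $\mathrm{Row}^3(I)=[0,1,n-1:\varnothing]$.
   Context: $[2]\times[n]=\{(i,j): i\in\{1,2\},1\le j\le n\}$ with the componentwise order; lower chain $\{1\}\times[n]$, upper chain $\{2\}\times[n]$. An interval-closed set (ICS) is a subset $I$ with $x,y\in I$, $x\le z\le y\Rightarrow z\in I$. The toggle $t_x$ sends $I$ to $I\triangle\{x\}$ if this is an ICS, and to $I$ otherwise; rowmotion is $\mathrm{Row}=t_{x_1}\circ\cdots\circ t_{x_N}$ for any linear extension $x_1,\dots,x_N$ (toggles applied top to bottom). For nonnegative $b+i+a=n$, $[b,i,a:\varnothing]=\{(1,j): b<j\le b+i\}$ and $[\varnothing:b,i,a]=\{(2,j): b<j\le b+i\}$. A Low ICS is a nonempty ICS contained in the lower chain; a High ICS is a nonempty ICS contained in the upper chain. -}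

module Defs where

open import Data.Bool using (Bool; true; false; _∧_; _∨_; not; if_then_else_)
open import Data.Nat using (ℕ; _≤ᵇ_; _<ᵇ_; _+_; _≡ᵇ_)
open import Data.Fin using (Fin; toℕ; zero; suc)
open import Data.Fin.Properties using (_≟_)
open import Data.Product using (_×_; _,_; ∃)
open import Data.List using (List; []; _∷_; map; concatMap; foldr; allFin)
open import Relation.Nullary.Decidable using (⌊_⌋)
open import Relation.Binary.PropositionalEquality using (_≡_)

allB : ∀ {A : Set} → (A → Bool) → List A → Bool
allB p [] = true
allB p (x ∷ xs) = p x ∧ allB p xs

-- Elements of [2]×[n]: (r , j) with r : Fin 2 (0 = lower chain {1}×[n],
-- 1 = upper chain {2}×[n]) and j : Fin n (j stands for the element j+1 of [n]).
Elt : ℕ → Set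
Elt n = Fin 2 × Fin n

_≤E_ : ∀ {n} → Elt n → Elt n → Bool
(r , j) ≤E (r' , j') = (toℕ r ≤ᵇ toℕ r') ∧ (toℕ j ≤ᵇ toℕ j')

_≟E_ : ∀ {n} → Elt n → Elt n → Bool
(r , j) ≟E (r' , j') = ⌊ r ≟ r' ⌋ ∧ ⌊ j ≟ j' ⌋

Subset : ℕ → Set
Subset n = Elt n → Bool

elts : ∀ n → List (Elt n)
elts n = concatMap (λ r → map (λ j → (r , j)) (allFin n)) (allFin 2)

isICS : ∀ {n} → Subset n → Bool
isICS {n} S =
  allB (λ x → allB (λ y → allB (λ z →
        not (S x ∧ S y ∧ (x ≤E z) ∧ (z ≤E y)) ∨ S z) (elts n)) (elts n)) (elts n)

ICS : ∀ {n} → Subset n → Set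
ICS S = isICS S ≡ true

flipAt : ∀ {n} → Elt n → Subset n → Subset n
flipAt x S y = if y ≟E x then not (S y) else S y

toggle : ∀ {n} → Elt n → Subset n → Subset n
toggle x S = if isICS (flipAt x S) then flipAt x S else S

-- The linear extension (1,1),(1,2),…,(1,n),(2,1),…,(2,n) (this is elts n).
-- Row = t_{x_1} ∘ ⋯ ∘ t_{x_N}: toggles applied from the top (x_N) down.
Row : ∀ {n} → Subset n → Subset n
Row {n} S = foldr toggle S (elts n)

_≐_ : ∀ {n} → Subset n → Subset n → Set
_≐_ {n} S T = ∀ (x : Elt n) → S x ≡ T x

-- [b,i,a:∅] = {(1,j) : b < j ≤ b+i} and [∅:b,i,a] = {(2,j) : b < j ≤ b+i};
-- with 0-based j' = j-1 this is b ≤ j' < b+i. (a is determined by b+i+a=n.)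
lowI : ∀ {n} → ℕ → ℕ → Subset n
lowI b i (zero , j) = (b ≤ᵇ toℕ j) ∧ (toℕ j <ᵇ b + i)
lowI b i (suc _ , j) = false

highI : ∀ {n} → ℕ → ℕ → Subset n
highI b i (zero , j) = false
highI b i (suc _ , j) = (b ≤ᵇ toℕ j) ∧ (toℕ j <ᵇ b + i)

Nonempty : ∀ {n} → Subset n → Set
Nonempty S = ∃ λ x → S x ≡ true

Low : ∀ {n} → Subset n → Set
Low {n} S = ICS S × Nonempty S × (∀ (j : Fin n) → S (suc zero , j) ≡ false)

High : ∀ {n} → Subset n → Set
High {n} S = ICS S × Nonempty S × (∀ (j : Fin n) → S (zero , j) ≡ false)

{-# OPTIONS --safe #-}
module Submission where

-- Every set on the orbit has one half-open interval of (0-based) positions on each chain;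
-- write L : U for the set with L on the lower and U on the upper chain. Toggling position k
-- of one chain, the other chain being fixed, can only change that chain's interval when k
-- is next to one of its ends, and whether such a move is accepted depends only on how the
-- two resulting intervals lie relative to each other; any other toggle breaks the convexity
-- of a nonempty interval and is rejected. A sweep along a chain is therefore a sequence of
-- frozen ranges, single moves and runs of moves, and with c = b + i rowmotion acts as
--   a ≥ 1 :  ∅ : [b,c)  ↦  [b+1,n) : [b+1,c+1)
--     a ≥ 2 :  ↦  [b+2,c+2) : [0,c+2)  ↦  [b+3,c+3) : ∅  if a ≥ 3,  [0,b+2) : ∅  if a = 2
--     a = 1 :  ↦  [0,b+1) : [0,b+1)    ↦  [1,b+2) : ∅
--   a = 0 :  ∅ : [b,n)  ↦  [0,n) : [0,b)  ↦  [1,b+1) : [0,b+1)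
--                       ↦  [2,b+2) : ∅  if i > 1,  [0,1) : ∅  if i = 1
-- The first two iterates meet both chains, and the third is the Low ICS of the statement.

open import Defs
open import Data.Nat
  using (ℕ; zero; suc; _+_; _∸_; _≤_; _<_; z≤n; s≤s; _<?_; _≤′_; ≤′-refl; ≤′-step; _≤ᵇ_; _<ᵇ_; _≡ᵇ_)
open import Data.Nat.Properties
open import Algebra.Properties.CommutativeSemigroup +-commutativeSemigroup using (xy∙z≈xz∙y)
open import Data.Bool using (Bool; true; false; _∧_; _∨_; not; if_then_else_; T)
open import Data.Bool.Properties using (T-≡; ¬-not; ∧-zeroʳ; ⇔→≡; not-involutive)
open import Data.Empty using (⊥-elim)
open import Data.Fin using (Fin; toℕ; fromℕ<; zero; suc)
open import Data.Fin.Properties using (toℕ-fromℕ<; toℕ-injective) renaming (_≟_ to _≟ᶠ_)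
open import Data.List using (List; []; _∷_; foldr; tabulate; map; allFin; _++_)
open import Data.List.Membership.Propositional using (_∈_)
open import Data.List.Membership.Propositional.Properties using (∈-cartesianProduct⁺; ∈-allFin)
open import Data.List.Properties using (foldr-++; map-tabulate; ++-identityʳ)
open import Data.List.Relation.Unary.Any using (here; there)
open import Data.Product using (_×_; _,_; proj₁; proj₂; ∃)
open import Data.Sum using (inj₁; inj₂)
open import Function.Bundles using (Equivalence; mk⇔)
open import Relation.Nullary using (¬_; yes; no)
open import Relation.Nullary.Decidable using (⌊_⌋)
open import Relation.Binary.PropositionalEquality
  using (_≡_; _≢_; refl; sym; trans; cong; cong₂; subst; subst₂; ≢-sym; module ≡-Reasoning)

private
  variable
    n k l u : ℕ

T⇒true : ∀ {b} → T b → b ≡ true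
T⇒true = Equivalence.to T-≡

true⇒T : ∀ {b} → b ≡ true → T b
true⇒T = Equivalence.from T-≡

¬T⇒false : ∀ {b} → ¬ T b → b ≡ false
¬T⇒false ¬b = ¬-not (λ b≡true → ¬b (true⇒T b≡true))

≤ᵇ≡true⇒≤ : ∀ {m n} → (m ≤ᵇ n) ≡ true → m ≤ n
≤ᵇ≡true⇒≤ {m} {n} m≤ᵇn = ≤ᵇ⇒≤ m n (true⇒T m≤ᵇn)

data Interval : Set where
  [_,_⟩ : ℕ → ℕ → Interval

_∈ᵢ_ : ℕ → Interval → Bool
x ∈ᵢ [ l , u ⟩ = (l ≤ᵇ x) ∧ (x <ᵇ u)

∅ : Interval
∅ = [ 0 , 0 ⟩

∈ᵢ-intro : ∀ {l u x} → l ≤ x → x < u → (x ∈ᵢ [ l , u ⟩) ≡ true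
∈ᵢ-intro l≤x x<u = cong₂ _∧_ (T⇒true (≤⇒≤ᵇ l≤x)) (T⇒true (<⇒<ᵇ x<u))

∈ᵢ-elim : ∀ {l u x} → (x ∈ᵢ [ l , u ⟩) ≡ true → l ≤ x × x < u
∈ᵢ-elim {l} {u} {x} x∈ with l ≤ᵇ x in l≤ᵇx | x <ᵇ u in x<ᵇu
... | true | true = ≤ᵇ⇒≤ l x (true⇒T l≤ᵇx) , <ᵇ⇒< x u (true⇒T x<ᵇu)

∉ᵢ-below : ∀ {l u x} → x < l → (x ∈ᵢ [ l , u ⟩) ≡ false
∉ᵢ-below {l} {u} {x} x<l
  rewrite ¬T⇒false (λ l≤ᵇx → <⇒≱ x<l (≤ᵇ⇒≤ l x l≤ᵇx)) = refl

∉ᵢ-above : ∀ {l u x} → u ≤ x → (x ∈ᵢ [ l , u ⟩) ≡ false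
∉ᵢ-above {l} {u} {x} u≤x
  rewrite ¬T⇒false (λ x<ᵇu → ≤⇒≯ u≤x (<ᵇ⇒< x u x<ᵇu)) = ∧-zeroʳ (l ≤ᵇ x)

∉ᵢ-empty : ∀ m x → (x ∈ᵢ [ m , m ⟩) ≡ false
∉ᵢ-empty m x with x <? m
... | yes x<m = ∉ᵢ-below {m} {m} x<m
... | no x≮m = ∉ᵢ-above {m} {m} (≮⇒≥ x≮m)

∈ᵢ-convex : ∀ {X a b z} → (a ∈ᵢ X) ≡ true → (b ∈ᵢ X) ≡ true → a ≤ z → z ≤ b →
  (z ∈ᵢ X) ≡ true
∈ᵢ-convex {[ l , u ⟩} a∈ b∈ a≤z z≤b
  with l≤a , _ ← ∈ᵢ-elim {l} {u} a∈ | _ , b<u ← ∈ᵢ-elim {l} {u} b∈ =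
  ∈ᵢ-intro {l} {u} (≤-trans l≤a a≤z) (≤-<-trans z≤b b<u)

<ᵇ-suc : ∀ {x k} → x ≢ k → (x <ᵇ suc k) ≡ (x <ᵇ k)
<ᵇ-suc {x} {k} x≢k = ⇔→≡ {z = true} (mk⇔
  (λ x<ᵇ1+k → T⇒true (<⇒<ᵇ (≤∧≢⇒< (≤-pred (<ᵇ⇒< x (suc k) (true⇒T x<ᵇ1+k))) x≢k)))
  (λ x<ᵇk → T⇒true (<⇒<ᵇ (m<n⇒m<1+n (<ᵇ⇒< x k (true⇒T x<ᵇk))))))

≤ᵇ-suc : ∀ {k x} → x ≢ k → (suc k ≤ᵇ x) ≡ (k ≤ᵇ x)
≤ᵇ-suc {k} {x} x≢k = ⇔→≡ {z = true} (mk⇔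
  (λ k<ᵇx → T⇒true (≤⇒≤ᵇ (<⇒≤ (≤ᵇ⇒≤ (suc k) x (true⇒T k<ᵇx)))))
  (λ k≤ᵇx → T⇒true (≤⇒≤ᵇ (≤∧≢⇒< (≤ᵇ⇒≤ k x (true⇒T k≤ᵇx)) (≢-sym x≢k)))))

-- Interval-closedness

IntervalClosed : Subset n → Set
IntervalClosed {n} S = ∀ (x y z : Elt n) →
  S x ≡ true → S y ≡ true → (x ≤E z) ≡ true → (z ≤E y) ≡ true → S z ≡ true

allB-intro : ∀ {A : Set} (p : A → Bool) (xs : List A) → (∀ x → p x ≡ true) → allB p xs ≡ true
allB-intro p [] _ = refl
allB-intro p (x ∷ xs) h rewrite h x = allB-intro p xs h

allB-∈ : ∀ {A : Set} {p : A → Bool} {xs : List A} {x} → allB p xs ≡ true → x ∈ xs → p x ≡ true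
allB-∈ {p = p} {x ∷ _} holds (here refl) with p x
... | true = refl
allB-∈ {p = p} {y ∷ _} holds (there x∈) with p y
... | true = allB-∈ holds x∈

allB-cong : ∀ {A : Set} {p q : A → Bool} (xs : List A) → (∀ x → p x ≡ q x) →
  allB p xs ≡ allB q xs
allB-cong [] _ = refl
allB-cong (x ∷ xs) p≗q = cong₂ _∧_ (p≗q x) (allB-cong xs p≗q)

-- `elts n` unfolds to `cartesianProduct (allFin 2) (allFin n)`.
∈-elts : (x : Elt n) → x ∈ elts n
∈-elts (r , j) = ∈-cartesianProduct⁺ (∈-allFin r) (∈-allFin j)

implication-intro : ∀ a b c d e → (a ≡ true → b ≡ true → c ≡ true → d ≡ true → e ≡ true) →
  (not (a ∧ b ∧ c ∧ d) ∨ e) ≡ true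
implication-intro true true true true e h = h refl refl refl refl
implication-intro false b c d e h = refl
implication-intro true false c d e h = refl
implication-intro true true false d e h = refl
implication-intro true true true false e h = refl

implication-elim : ∀ {a b c d e} → (not (a ∧ b ∧ c ∧ d) ∨ e) ≡ true →
  a ≡ true → b ≡ true → c ≡ true → d ≡ true → e ≡ true
implication-elim h refl refl refl refl = h

closed⇒ICS : (S : Subset n) → IntervalClosed S → ICS S
closed⇒ICS {n} S closed =
  allB-intro _ (elts n) λ x → allB-intro _ (elts n) λ y → allB-intro _ (elts n) λ z →
  implication-intro (S x) (S y) (x ≤E z) (z ≤E y) (S z) (closed x y z)

ICS⇒closed : (S : Subset n) → ICS S → IntervalClosed S
ICS⇒closed S ics x y z =
  implication-elim (allB-∈ (allB-∈ (allB-∈ ics (∈-elts x)) (∈-elts y)) (∈-elts z))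

violation⇒¬ICS : (S : Subset n) (x y z : Elt n) →
  S x ≡ true → S y ≡ true → (x ≤E z) ≡ true → (z ≤E y) ≡ true → S z ≡ false → ¬ ICS S
violation⇒¬ICS S x y z Sx Sy x≤z z≤y Sz ics
  with () ← trans (sym Sz) (ICS⇒closed S ics x y z Sx Sy x≤z z≤y)

isICS-cong : {S T : Subset n} → S ≐ T → isICS S ≡ isICS T
isICS-cong {n} S≐T =
  allB-cong (elts n) λ x → allB-cong (elts n) λ y → allB-cong (elts n) λ z →
  cong₂ (λ a b → not a ∨ b) (cong₂ _∧_ (S≐T x) (cong (_∧ _) (S≐T y))) (S≐T z)

-- Sets given by one interval on each chain

pattern lower = zero
pattern upper = suc zero

ChainSet : Set
ChainSet = ℕ → Bool

byChains : ChainSet → ChainSet → Subset n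
byChains A B (lower , j) = A (toℕ j)
byChains A B (upper , j) = B (toℕ j)

onChain : Fin 2 → ChainSet → ChainSet → Subset n
onChain lower A B = byChains A B
onChain upper A B = byChains B A

shape : Interval → Interval → Subset n
shape L U = byChains (_∈ᵢ L) (_∈ᵢ U)

shapeOn : Fin 2 → Interval → Interval → Subset n
shapeOn r X Y = onChain r (_∈ᵢ X) (_∈ᵢ Y)

-- Sufficient for `shape L U` to be interval-closed; for nonempty L and U the other cases are
-- excluded by `starts-before-¬ICS` and `ends-before-¬ICS`.
data Compatible : Interval → Interval → Set where
  lower-empty  : ∀ {l₁ l₂ U} → l₂ ≤ l₁ → Compatible [ l₁ , l₂ ⟩ U
  upper-empty  : ∀ {L u₁ u₂} → u₂ ≤ u₁ → Compatible L [ u₁ , u₂ ⟩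
  upper-below  : ∀ {l₁ l₂ u₁ u₂} → u₂ ≤ l₁ → Compatible [ l₁ , l₂ ⟩ [ u₁ , u₂ ⟩
  upper-behind : ∀ {l₁ l₂ u₁ u₂} → u₁ ≤ l₁ → u₂ ≤ l₂ →
                 Compatible [ l₁ , l₂ ⟩ [ u₁ , u₂ ⟩

CompatibleOn : Fin 2 → Interval → Interval → Set
CompatibleOn lower X Y = Compatible X Y
CompatibleOn upper X Y = Compatible Y X

compatible-∅ : ∀ r {X} → CompatibleOn r X ∅
compatible-∅ lower = upper-empty z≤n
compatible-∅ upper = lower-empty z≤n

compatible-closed : ∀ {L U a b z} → Compatible L U → (a ∈ᵢ L) ≡ true → (b ∈ᵢ U) ≡ true →
  a ≤ z → z ≤ b → (z ∈ᵢ L) ≡ true × (z ∈ᵢ U) ≡ true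
compatible-closed {[ l₁ , l₂ ⟩} (lower-empty l₂≤l₁) a∈L _ _ _
  with l₁≤a , a<l₂ ← ∈ᵢ-elim {l₁} {l₂} a∈L
  = ⊥-elim (<⇒≱ (≤-<-trans l₁≤a a<l₂) l₂≤l₁)
compatible-closed {U = [ u₁ , u₂ ⟩} (upper-empty u₂≤u₁) _ b∈U _ _
  with u₁≤b , b<u₂ ← ∈ᵢ-elim {u₁} {u₂} b∈U
  = ⊥-elim (<⇒≱ (≤-<-trans u₁≤b b<u₂) u₂≤u₁)
compatible-closed {[ l₁ , l₂ ⟩} {[ u₁ , u₂ ⟩} (upper-below u₂≤l₁) a∈L b∈U a≤z z≤b
  with l₁≤a , _ ← ∈ᵢ-elim {l₁} {l₂} a∈L | _ , b<u₂ ← ∈ᵢ-elim {u₁} {u₂} b∈U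
  = ⊥-elim (<⇒≱ (≤-<-trans (≤-trans l₁≤a (≤-trans a≤z z≤b)) b<u₂) u₂≤l₁)
compatible-closed {[ l₁ , l₂ ⟩} {[ u₁ , u₂ ⟩} (upper-behind u₁≤l₁ u₂≤l₂) a∈L b∈U a≤z z≤b
  with l₁≤a , _ ← ∈ᵢ-elim {l₁} {l₂} a∈L | _ , b<u₂ ← ∈ᵢ-elim {u₁} {u₂} b∈U
  = ∈ᵢ-intro {l₁} {l₂} (≤-trans l₁≤a a≤z) (<-≤-trans (≤-<-trans z≤b b<u₂) u₂≤l₂)
  , ∈ᵢ-intro {u₁} {u₂} (≤-trans u₁≤l₁ (≤-trans l₁≤a a≤z)) (≤-<-trans z≤b b<u₂)

shape-ICS : ∀ {L U} → Compatible L U → ICS (shape {n} L U)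
shape-ICS {n} {L} {U} compatible = closed⇒ICS (shape L U) closed
  where
  closed : IntervalClosed (shape {n} L U)
  closed (lower , _) (lower , _) (lower , _) x∈ y∈ x≤z z≤y =
    ∈ᵢ-convex {L} x∈ y∈ (≤ᵇ≡true⇒≤ x≤z) (≤ᵇ≡true⇒≤ z≤y)
  closed (upper , _) (upper , _) (upper , _) x∈ y∈ x≤z z≤y =
    ∈ᵢ-convex {U} x∈ y∈ (≤ᵇ≡true⇒≤ x≤z) (≤ᵇ≡true⇒≤ z≤y)
  closed (lower , _) (upper , _) (lower , _) x∈ y∈ x≤z z≤y =
    proj₁ (compatible-closed compatible x∈ y∈ (≤ᵇ≡true⇒≤ x≤z) (≤ᵇ≡true⇒≤ z≤y))
  closed (lower , _) (upper , _) (upper , _) x∈ y∈ x≤z z≤y =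
    proj₂ (compatible-closed compatible x∈ y∈ (≤ᵇ≡true⇒≤ x≤z) (≤ᵇ≡true⇒≤ z≤y))
  closed (lower , _) (lower , _) (upper , _) _ _ _ ()
  closed (upper , _) _ (lower , _) _ _ () _
  closed (upper , _) (lower , _) (upper , _) _ _ _ ()

shapeOn-ICS : ∀ r {X Y} → CompatibleOn r X Y → ICS (shapeOn {n} r X Y)
shapeOn-ICS {n} lower = shape-ICS {n}
shapeOn-ICS {n} upper = shape-ICS {n}

at : Fin 2 → k < n → Elt n
at r k<n = r , fromℕ< k<n

at-≤E : ∀ r s {m} (k<n : k < n) (m<n : m < n) → toℕ r ≤ toℕ s → k ≤ m →
  (at r k<n ≤E at s m<n) ≡ true
at-≤E r s k<n m<n r≤s k≤m
  rewrite toℕ-fromℕ< k<n | toℕ-fromℕ< m<n =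
  cong₂ _∧_ (T⇒true (≤⇒≤ᵇ r≤s)) (T⇒true (≤⇒≤ᵇ k≤m))

onChain-at : ∀ r (A : ChainSet) {B b} (k<n : k < n) → A k ≡ b → onChain r A B (at r k<n) ≡ b
onChain-at lower A k<n Ak = trans (cong A (toℕ-fromℕ< k<n)) Ak
onChain-at upper A k<n Ak = trans (cong A (toℕ-fromℕ< k<n)) Ak

∈ᵢ-fromℕ< : ∀ X (k<n : k < n) {b} → (k ∈ᵢ X) ≡ b → (toℕ (fromℕ< k<n) ∈ᵢ X) ≡ b
∈ᵢ-fromℕ< X k<n k∈ = trans (cong (_∈ᵢ X) (toℕ-fromℕ< k<n)) k∈

chain-gap-¬ICS : ∀ r {A B p m q} → q < n → p ≤ m → m ≤ q →
  A p ≡ true → A q ≡ true → A m ≡ false → ¬ ICS (onChain {n} r A B)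
chain-gap-¬ICS r {A} {B} q<n p≤m m≤q Ap Aq Am =
  violation⇒¬ICS (onChain r A B) (at r p<n) (at r q<n) (at r m<n)
    (onChain-at r A p<n Ap) (onChain-at r A q<n Aq)
    (at-≤E r r p<n m<n ≤-refl p≤m) (at-≤E r r m<n q<n ≤-refl m≤q) (onChain-at r A m<n Am)
  where
  m<n = ≤-<-trans m≤q q<n
  p<n = ≤-<-trans p≤m m<n

starts-before-¬ICS : ∀ {l₁ l₂ u₁ v} → l₁ < l₂ → l₁ < u₁ → u₁ ≤ v → v < n →
  ¬ ICS (shape {n} [ l₁ , l₂ ⟩ [ u₁ , suc v ⟩)
starts-before-¬ICS {n} {l₁} {l₂} {u₁} {v} l₁<l₂ l₁<u₁ u₁≤v v<n =
  violation⇒¬ICS (shape [ l₁ , l₂ ⟩ [ u₁ , suc v ⟩) (at lower l₁<n) (at upper v<n) (at upper l₁<n)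
    (∈ᵢ-fromℕ< [ l₁ , l₂ ⟩ l₁<n (∈ᵢ-intro {l₁} {l₂} ≤-refl l₁<l₂))
    (∈ᵢ-fromℕ< [ u₁ , suc v ⟩ v<n (∈ᵢ-intro {u₁} {suc v} u₁≤v ≤-refl))
    (at-≤E lower upper l₁<n l₁<n z≤n ≤-refl) (at-≤E upper upper l₁<n v<n ≤-refl l₁≤v)
    (∈ᵢ-fromℕ< [ u₁ , suc v ⟩ l₁<n (∉ᵢ-below {u₁} {suc v} l₁<u₁))
  where
  l₁≤v = <⇒≤ (<-≤-trans l₁<u₁ u₁≤v)
  l₁<n = ≤-<-trans l₁≤v v<n

ends-before-¬ICS : ∀ {l₁ l₂ u₁ v} → l₁ < l₂ → l₂ ≤ v → u₁ ≤ v → v < n →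
  ¬ ICS (shape {n} [ l₁ , l₂ ⟩ [ u₁ , suc v ⟩)
ends-before-¬ICS {n} {l₁} {l₂} {u₁} {v} l₁<l₂ l₂≤v u₁≤v v<n =
  violation⇒¬ICS (shape [ l₁ , l₂ ⟩ [ u₁ , suc v ⟩) (at lower l₁<n) (at upper v<n) (at lower l₂<n)
    (∈ᵢ-fromℕ< [ l₁ , l₂ ⟩ l₁<n (∈ᵢ-intro {l₁} {l₂} ≤-refl l₁<l₂))
    (∈ᵢ-fromℕ< [ u₁ , suc v ⟩ v<n (∈ᵢ-intro {u₁} {suc v} u₁≤v ≤-refl))
    (at-≤E lower lower l₁<n l₂<n z≤n (<⇒≤ l₁<l₂)) (at-≤E lower upper l₂<n v<n z≤n l₂≤v)
    (∈ᵢ-fromℕ< [ l₁ , l₂ ⟩ l₂<n (∉ᵢ-above {l₁} {l₂} ≤-refl))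
  where
  l₂<n = ≤-<-trans l₂≤v v<n
  l₁<n = <-trans l₁<l₂ l₂<n

-- Toggles and sweeps

flipOn : Fin 2 → ℕ → Subset n → Subset n
flipOn r k S x@(r′ , j) = if ⌊ r′ ≟ᶠ r ⌋ ∧ (toℕ j ≡ᵇ k) then not (S x) else S x

toggleAt : Fin 2 → ℕ → Subset n → Subset n
toggleAt r k S = if isICS (flipOn r k S) then flipOn r k S else S

≟ᶠ-≡ᵇ : (i j : Fin n) → ⌊ i ≟ᶠ j ⌋ ≡ (toℕ i ≡ᵇ toℕ j)
≟ᶠ-≡ᵇ i j with i ≟ᶠ j
... | yes refl = sym (T⇒true (≡⇒≡ᵇ (toℕ i) (toℕ i) refl))
... | no i≢j = sym (¬T⇒false (λ eq → i≢j (toℕ-injective (≡ᵇ⇒≡ (toℕ i) (toℕ j) eq))))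

flipAt≐flipOn : ∀ r (j : Fin n) S → flipAt (r , j) S ≐ flipOn r (toℕ j) S
flipAt≐flipOn r j S (r′ , j′) rewrite ≟ᶠ-≡ᵇ j′ j = refl

toggle≐toggleAt : ∀ r (j : Fin n) S → toggle (r , j) S ≐ toggleAt r (toℕ j) S
toggle≐toggleAt r j S x
  rewrite isICS-cong (flipAt≐flipOn r j S) with isICS (flipOn r (toℕ j) S)
... | true = flipAt≐flipOn r j S x
... | false = refl

flipOn-cong : ∀ r k {S T : Subset n} → S ≐ T → flipOn r k S ≐ flipOn r k T
flipOn-cong r k S≐T (r′ , j) rewrite S≐T (r′ , j) = refl

toggleAt-cong : ∀ r k {S T : Subset n} → S ≐ T → toggleAt r k S ≐ toggleAt r k T
toggleAt-cong r k {S} {T} S≐T x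
  rewrite isICS-cong (flipOn-cong r k S≐T) with isICS (flipOn r k T)
... | true = flipOn-cong r k S≐T x
... | false = S≐T x

toggleAt-accept : ∀ r k {S T : Subset n} → flipOn r k S ≐ T → ICS T → toggleAt r k S ≐ T
toggleAt-accept r k flip≐T ics x rewrite isICS-cong flip≐T | ics = flip≐T x

toggleAt-reject : ∀ r k {S : Subset n} → ¬ ICS (flipOn r k S) → toggleAt r k S ≐ S
toggleAt-reject r k ¬ics x rewrite ¬-not ¬ics = refl

sweepFrom : Fin 2 → ℕ → ℕ → Subset n → Subset n
sweepFrom r lo zero S = S
sweepFrom r lo (suc c) S = toggleAt r lo (sweepFrom r (suc lo) c S)

sweep : Fin 2 → ℕ → ℕ → Subset n → Subset n
sweep r lo hi = sweepFrom r lo (hi ∸ lo)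

sweepFrom-cong : ∀ r lo c {S T : Subset n} → S ≐ T → sweepFrom r lo c S ≐ sweepFrom r lo c T
sweepFrom-cong r lo zero S≐T = S≐T
sweepFrom-cong r lo (suc c) S≐T = toggleAt-cong r lo (sweepFrom-cong r (suc lo) c S≐T)

sweepFrom-+ : ∀ r lo c₁ c₂ (S : Subset n) →
  sweepFrom r lo (c₁ + c₂) S ≡ sweepFrom r lo c₁ (sweepFrom r (lo + c₁) c₂ S)
sweepFrom-+ r lo zero c₂ S rewrite +-identityʳ lo = refl
sweepFrom-+ r lo (suc c₁) c₂ S rewrite +-suc lo c₁ = cong (toggleAt r lo) (sweepFrom-+ r (suc lo) c₁ c₂ S)

sweep-split : ∀ r {lo m hi} (S : Subset n) → lo ≤ m → m ≤ hi →
  sweep r lo hi S ≡ sweep r lo m (sweep r m hi S)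
sweep-split r {lo} {m} {hi} S lo≤m m≤hi = begin
  sweepFrom r lo (hi ∸ lo) S
    ≡⟨ cong (λ c → sweepFrom r lo c S) (sym lengths) ⟩
  sweepFrom r lo ((m ∸ lo) + (hi ∸ m)) S
    ≡⟨ sweepFrom-+ r lo (m ∸ lo) (hi ∸ m) S ⟩
  sweepFrom r lo (m ∸ lo) (sweepFrom r (lo + (m ∸ lo)) (hi ∸ m) S)
    ≡⟨ cong (λ l → sweepFrom r lo (m ∸ lo) (sweepFrom r l (hi ∸ m) S)) (m+[n∸m]≡n lo≤m) ⟩
  sweepFrom r lo (m ∸ lo) (sweepFrom r m (hi ∸ m) S) ∎
  where
  open ≡-Reasoning
  lengths : (m ∸ lo) + (hi ∸ m) ≡ hi ∸ lo
  lengths = begin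
    (m ∸ lo) + (hi ∸ m) ≡⟨ +-∸-comm (hi ∸ m) lo≤m ⟨
    (m + (hi ∸ m)) ∸ lo ≡⟨ cong (_∸ lo) (m+[n∸m]≡n m≤hi) ⟩
    hi ∸ lo             ∎

toggles-tabulate : ∀ r lo c (f : Fin c → Fin n) → (∀ j → toℕ (f j) ≡ lo + toℕ j) →
  (S : Subset n) → foldr toggle S (tabulate (λ j → r , f j)) ≐ sweepFrom r lo c S
toggles-tabulate r lo zero f f≡ S x = refl
toggles-tabulate r lo (suc c) f f≡ S x = begin
  toggle (r , f zero) rest x                 ≡⟨ toggle≐toggleAt r (f zero) rest x ⟩
  toggleAt r (toℕ (f zero)) rest x           ≡⟨ cong (λ k → toggleAt r k rest x) f₀≡lo ⟩
  toggleAt r lo rest x                       ≡⟨ toggleAt-cong r lo rest≐ x ⟩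
  toggleAt r lo (sweepFrom r (suc lo) c S) x ∎
  where
  open ≡-Reasoning
  rest = foldr toggle S (tabulate (λ j → r , f (suc j)))
  f₀≡lo = trans (f≡ zero) (+-identityʳ lo)
  rest≐ : rest ≐ sweepFrom r (suc lo) c S
  rest≐ = toggles-tabulate r (suc lo) c (λ j → f (suc j)) (λ j → trans (f≡ (suc j)) (+-suc lo (toℕ j))) S

toggles-chain : ∀ r (S : Subset n) → foldr toggle S (map (r ,_) (allFin n)) ≐ sweep r 0 n S
toggles-chain {n} r S rewrite map-tabulate {n = n} (λ j → j) (r ,_) =
  toggles-tabulate r 0 n (λ j → j) (λ j → refl) S

Row≐sweeps : (S : Subset n) → Row S ≐ sweep lower 0 n (sweep upper 0 n S)
Row≐sweeps {n} S x = begin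
  Row S x
    ≡⟨⟩
  foldr toggle S (lowerChain ++ upperChain ++ []) x
    ≡⟨ cong (λ T → T x) (foldr-++ toggle S lowerChain _) ⟩
  foldr toggle (foldr toggle S (upperChain ++ [])) lowerChain x
    ≡⟨ cong (λ l → foldr toggle (foldr toggle S l) lowerChain x) (++-identityʳ upperChain) ⟩
  foldr toggle (foldr toggle S upperChain) lowerChain x
    ≡⟨ toggles-chain lower _ x ⟩
  sweep lower 0 n (foldr toggle S upperChain) x
    ≡⟨ sweepFrom-cong lower 0 n (toggles-chain upper S) x ⟩
  sweep lower 0 n (sweep upper 0 n S) x ∎
  where
  open ≡-Reasoning
  lowerChain = map (lower ,_) (allFin n)
  upperChain = map (upper ,_) (allFin n)

Row-cong : {S T : Subset n} → S ≐ T → Row S ≐ Row T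
Row-cong {n} {S} {T} S≐T x = begin
  Row S x                               ≡⟨ Row≐sweeps S x ⟩
  sweep lower 0 n (sweep upper 0 n S) x ≡⟨ sweepFrom-cong lower 0 n (sweepFrom-cong upper 0 n S≐T) x ⟩
  sweep lower 0 n (sweep upper 0 n T) x ≡⟨ Row≐sweeps T x ⟨
  Row T x                               ∎
  where open ≡-Reasoning

Row-via : {S T U : Subset n} → S ≐ T → Row T ≐ U → Row S ≐ U
Row-via S≐T RowT≐U x = trans (Row-cong S≐T x) (RowT≐U x)

flip : ℕ → ChainSet → ChainSet
flip k A x = if x ≡ᵇ k then not (A x) else A x

flipOn-onChain : ∀ r k (A B : ChainSet) → flipOn {n} r k (onChain r A B) ≐ onChain r (flip k A) B
flipOn-onChain lower k A B (lower , j) = refl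
flipOn-onChain lower k A B (upper , j) = refl
flipOn-onChain upper k A B (lower , j) = refl
flipOn-onChain upper k A B (upper , j) = refl

onChain-cong : ∀ r {A A′ B : ChainSet} → (∀ x → A x ≡ A′ x) → onChain {n} r A B ≐ onChain r A′ B
onChain-cong lower A≗A′ (lower , j) = A≗A′ (toℕ j)
onChain-cong lower A≗A′ (upper , j) = refl
onChain-cong upper A≗A′ (lower , j) = refl
onChain-cong upper A≗A′ (upper , j) = A≗A′ (toℕ j)

flip-same : ∀ k (A : ChainSet) → flip k A k ≡ not (A k)
flip-same k A rewrite T⇒true (≡⇒≡ᵇ k k refl) = refl

flip-other : ∀ {x k} (A : ChainSet) → x ≢ k → flip k A x ≡ A x
flip-other {x} {k} A x≢k rewrite ¬T⇒false (λ x≡ᵇk → x≢k (≡ᵇ⇒≡ x k x≡ᵇk)) = refl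

flip-≗ : ∀ {k} {A B : ChainSet} → (∀ {x} → x ≢ k → A x ≡ B x) → A k ≡ not (B k) →
  ∀ x → flip k A x ≡ B x
flip-≗ {k} {A} {B} off at x with x ≟ k
... | yes refl = trans (flip-same x A) (trans (cong not at) (not-involutive (B x)))
... | no x≢k = trans (flip-other A x≢k) (off x≢k)

data Move (k : ℕ) : Interval → Interval → Set where
  extendTop    : l ≤ k → Move k [ l , k ⟩ [ l , suc k ⟩
  removeTop    : l ≤ k → Move k [ l , suc k ⟩ [ l , k ⟩
  extendBottom : k < u → Move k [ suc k , u ⟩ [ k , u ⟩
  removeBottom : k < u → Move k [ k , u ⟩ [ suc k , u ⟩

flip-move : ∀ {k X X′} → Move k X X′ → ∀ x → flip k (_∈ᵢ X) x ≡ (x ∈ᵢ X′)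
flip-move {k} (extendTop {l} l≤k) = flip-≗ (λ {x} x≢k → cong ((l ≤ᵇ x) ∧_) (sym (<ᵇ-suc x≢k)))
  (trans (∉ᵢ-above {l} {k} ≤-refl) (cong not (sym (∈ᵢ-intro {l} {suc k} l≤k ≤-refl))))
flip-move {k} (removeTop {l} l≤k) = flip-≗ (λ {x} x≢k → cong ((l ≤ᵇ x) ∧_) (<ᵇ-suc x≢k))
  (trans (∈ᵢ-intro {l} {suc k} l≤k ≤-refl) (cong not (sym (∉ᵢ-above {l} {k} ≤-refl))))
flip-move {k} (extendBottom {u} k<u) = flip-≗ (λ {x} x≢k → cong (_∧ (x <ᵇ u)) (≤ᵇ-suc x≢k))
  (trans (∉ᵢ-below {suc k} {u} ≤-refl) (cong not (sym (∈ᵢ-intro {k} {u} ≤-refl k<u))))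
flip-move {k} (removeBottom {u} k<u) = flip-≗ (λ {x} x≢k → cong (_∧ (x <ᵇ u)) (sym (≤ᵇ-suc x≢k)))
  (trans (∈ᵢ-intro {k} {u} ≤-refl k<u) (cong not (sym (∉ᵢ-below {suc k} {u} ≤-refl))))

flipOn-shapeOn : ∀ r {k X X′ Y} → Move k X X′ → flipOn {n} r k (shapeOn r X Y) ≐ shapeOn r X′ Y
flipOn-shapeOn r {k} move x = trans (flipOn-onChain r k _ _ x) (onChain-cong r (flip-move move) x)

-- Sweeps of one chain beside a fixed interval

record Sweep {n : ℕ} (r : Fin 2) (Y : Interval) (lo hi : ℕ) (X X′ : Interval) : Set where
  constructor mkSweep
  field
    lo≤hi : lo ≤ hi
    result : sweep {n} r lo hi (shapeOn r X Y) ≐ shapeOn r X′ Y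

infixr 5 _▸_

-- The upper range is swept first, so a chain `s₁ ▸ s₂ ▸ …` lists the ranges from the top down.
_▸_ : ∀ {r Y l m h X X′ X″} → Sweep {n} r Y m h X X′ → Sweep {n} r Y l m X′ X″ →
  Sweep {n} r Y l h X X″
_▸_ {r = r} {Y} {l} {m} {X = X} (mkSweep m≤h X↦X′) (mkSweep l≤m X′↦X″) =
  mkSweep (≤-trans l≤m m≤h) λ x →
    trans (cong (λ R → R x) (sweep-split r (shapeOn r X Y) l≤m m≤h))
          (trans (sweepFrom-cong r l (m ∸ l) X↦X′ x) (X′↦X″ x))

stay : ∀ {r Y X} → Sweep {n} r Y k k X X
stay {k = k} {r = r} {Y = Y} {X = X} =
  mkSweep ≤-refl λ x → cong (λ c → sweepFrom r k c (shapeOn r X Y) x) (n∸n≡0 k)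

single : ∀ {r Y X X′} → toggleAt r k (shapeOn r X Y) ≐ shapeOn r X′ Y → Sweep {n} r Y k (suc k) X X′
single {k = k} {r = r} {Y = Y} {X = X} toggled = mkSweep (n≤1+n k) λ x →
  trans (cong (λ c → sweepFrom r k c (shapeOn r X Y) x) (trans (cong (_∸ k) (+-comm 1 k)) (m+n∸m≡n k 1)))
        (toggled x)

Sweep-start-≗ : ∀ {r Y lo hi X₀ X X′} → (∀ x → (x ∈ᵢ X₀) ≡ (x ∈ᵢ X)) →
  Sweep {n} r Y lo hi X X′ → Sweep {n} r Y lo hi X₀ X′
Sweep-start-≗ {r = r} {lo = lo} {hi} X₀≗X (mkSweep lo≤hi X↦X′) =
  mkSweep lo≤hi λ x → trans (sweepFrom-cong r lo (hi ∸ lo) (onChain-cong r X₀≗X) x) (X↦X′ x)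

accept : ∀ r {k X X′ Y} → Move k X X′ → CompatibleOn r X′ Y →
  Sweep {n} r Y k (suc k) X X′
accept {n} r {k} {Y = Y} move compatible =
  single (toggleAt-accept r k (flipOn-shapeOn {n} r {Y = Y} move) (shapeOn-ICS {n} r compatible))

reject : ∀ r {k X X′ Y} → Move k X X′ → ¬ ICS (shapeOn {n} r X′ Y) →
  Sweep {n} r Y k (suc k) X X
reject {n} r {k} {Y = Y} move ¬ics =
  single (toggleAt-reject r k λ ics → ¬ics (trans (sym (isICS-cong (flipOn-shapeOn {n} r {Y = Y} move))) ics))

frozen : ∀ r {lo hi X Y} → lo ≤ hi →
  (∀ {k} → lo ≤ k → k < hi → ¬ ICS (onChain {n} r (flip k (_∈ᵢ X)) (_∈ᵢ Y))) →
  Sweep {n} r Y lo hi X X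
frozen {n} r {lo} {X = X} {Y} lo≤hi = go (≤⇒≤′ lo≤hi)
  where
  go : ∀ {hi} → lo ≤′ hi →
    (∀ {k} → lo ≤ k → k < hi → ¬ ICS (onChain {n} r (flip k (_∈ᵢ X)) (_∈ᵢ Y))) →
    Sweep {n} r Y lo hi X X
  go ≤′-refl _ = stay
  go (≤′-step {h} lo≤′h) gap =
    single (toggleAt-reject r h λ ics →
      gap (≤′⇒≤ lo≤′h) ≤-refl (trans (sym (isICS-cong (flipOn-onChain {n} r h _ _))) ics))
    ▸ go lo≤′h (λ lo≤k k<h → gap lo≤k (m<n⇒m<1+n k<h))

frozenAbove : ∀ r {x₁ x₂ Y} → x₁ < x₂ → suc x₂ ≤ n →
  Sweep {n} r Y (suc x₂) n [ x₁ , x₂ ⟩ [ x₁ , x₂ ⟩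
frozenAbove r {x₁} {x₂} x₁<x₂ x₂<n = frozen r x₂<n λ {k} x₂<k k<n →
  chain-gap-¬ICS r k<n (<⇒≤ x₁<x₂) (<⇒≤ x₂<k)
    (trans (flip-other X (<⇒≢ (<-trans x₁<x₂ x₂<k))) (∈ᵢ-intro {x₁} {x₂} ≤-refl x₁<x₂))
    (trans (flip-same k X) (cong not (∉ᵢ-above {x₁} {x₂} (<⇒≤ x₂<k))))
    (trans (flip-other X (<⇒≢ x₂<k)) (∉ᵢ-above {x₁} {x₂} ≤-refl))
  where X = _∈ᵢ [ x₁ , x₂ ⟩

frozenInside : ∀ r {x₁ x₂ Y} → x₁ < x₂ → suc x₂ ≤ n →
  Sweep {n} r Y (suc x₁) x₂ [ x₁ , suc x₂ ⟩ [ x₁ , suc x₂ ⟩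
frozenInside r {x₁} {x₂} x₁<x₂ x₂<n = frozen r x₁<x₂ λ {k} x₁<k k<x₂ →
  chain-gap-¬ICS r (<-≤-trans (s≤s k<x₂) x₂<n) (<⇒≤ x₁<k) (n≤1+n k)
    (trans (flip-other X (<⇒≢ x₁<k)) (∈ᵢ-intro {x₁} {suc x₂} ≤-refl (m<n⇒m<1+n x₁<x₂)))
    (trans (flip-other X (>⇒≢ (n<1+n k)))
           (∈ᵢ-intro {x₁} {suc x₂} (m≤n⇒m≤1+n (<⇒≤ x₁<k)) (s≤s k<x₂)))
    (trans (flip-same k X) (cong not (∈ᵢ-intro {x₁} {suc x₂} (<⇒≤ x₁<k) (m<n⇒m<1+n k<x₂))))
  where X = _∈ᵢ [ x₁ , suc x₂ ⟩

frozenBelow : ∀ r {x₁ x₂ Y} → suc x₁ < x₂ → x₂ ≤ n →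
  Sweep {n} r Y 0 x₁ [ suc x₁ , x₂ ⟩ [ suc x₁ , x₂ ⟩
frozenBelow r {x₁} {x₂} x₁<x₂ x₂≤n = frozen r z≤n λ {k} _ k<x₁ →
  chain-gap-¬ICS r (<-≤-trans x₁<x₂ x₂≤n) (n≤1+n k) (s≤s (<⇒≤ k<x₁))
    (trans (flip-same k X) (cong not (∉ᵢ-below {suc x₁} {x₂} (m<n⇒m<1+n k<x₁))))
    (trans (flip-other X (>⇒≢ (m<n⇒m<1+n k<x₁))) (∈ᵢ-intro {suc x₁} {x₂} ≤-refl x₁<x₂))
    (trans (flip-other X (>⇒≢ (n<1+n k))) (∉ᵢ-below {suc x₁} {x₂} (s≤s k<x₁)))
  where X = _∈ᵢ [ suc x₁ , x₂ ⟩

removeTops : ∀ r {l lo hi Y} → l ≤ lo → lo ≤ hi →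
  (∀ {k} → lo ≤ k → k < hi → CompatibleOn r [ l , k ⟩ Y) →
  Sweep {n} r Y lo hi [ l , hi ⟩ [ l , lo ⟩
removeTops {n} r {l} {lo} {Y = Y} l≤lo lo≤hi = go (≤⇒≤′ lo≤hi)
  where
  go : ∀ {hi} → lo ≤′ hi → (∀ {k} → lo ≤ k → k < hi → CompatibleOn r [ l , k ⟩ Y) →
    Sweep {n} r Y lo hi [ l , hi ⟩ [ l , lo ⟩
  go ≤′-refl _ = stay
  go (≤′-step lo≤′h) compatible =
    accept r (removeTop (≤-trans l≤lo (≤′⇒≤ lo≤′h))) (compatible (≤′⇒≤ lo≤′h) ≤-refl)
    ▸ go lo≤′h (λ lo≤k k<h → compatible lo≤k (m<n⇒m<1+n k<h))

extendBottoms : ∀ r {lo hi u Y} → lo ≤ hi → hi ≤ u →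
  (∀ {k} → lo ≤ k → k < hi → CompatibleOn r [ k , u ⟩ Y) →
  Sweep {n} r Y lo hi [ hi , u ⟩ [ lo , u ⟩
extendBottoms {n} r {lo} {u = u} {Y} lo≤hi = go (≤⇒≤′ lo≤hi)
  where
  go : ∀ {hi} → lo ≤′ hi → hi ≤ u →
    (∀ {k} → lo ≤ k → k < hi → CompatibleOn r [ k , u ⟩ Y) →
    Sweep {n} r Y lo hi [ hi , u ⟩ [ lo , u ⟩
  go ≤′-refl _ _ = stay
  go (≤′-step lo≤′h) h<u compatible =
    accept r (extendBottom h<u) (compatible (≤′⇒≤ lo≤′h) ≤-refl)
    ▸ go lo≤′h (<⇒≤ h<u) (λ lo≤k k<h → compatible lo≤k (m<n⇒m<1+n k<h))

sweep-shift : ∀ r {p q} → p < q → q < n → Sweep {n} r ∅ 0 n [ p , q ⟩ [ suc p , suc q ⟩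
sweep-shift r p<q q<n =
  frozenAbove r p<q q<n
  ▸ accept r (extendTop (<⇒≤ p<q)) (compatible-∅ r)
  ▸ frozenInside r p<q q<n
  ▸ accept r (removeBottom (m<n⇒m<1+n p<q)) (compatible-∅ r)
  ▸ frozenBelow r (s≤s p<q) q<n

sweep-complement : ∀ r {m Y} → m ≤ n →
  (∀ {k} → m ≤ k → k < n → CompatibleOn r [ m , k ⟩ Y) →
  (∀ {k} → k < m → CompatibleOn r [ k , m ⟩ Y) →
  Sweep {n} r Y 0 n [ m , n ⟩ [ 0 , m ⟩
sweep-complement r m≤n top bottom =
  removeTops r ≤-refl m≤n top ▸ extendBottoms r z≤n ≤-refl (λ _ → bottom)

sweepUpper-empty : ∀ {y q} → y < q → q ≤ n → Sweep {n} upper [ y , q ⟩ 0 n [ 0 , q ⟩ ∅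
sweepUpper-empty {n} {y} {q} y<q q≤n =
  blockedAbove ▸ removeTops upper z≤n z≤n (λ _ k<q → upper-behind z≤n (<⇒≤ k<q))
  where
  blockedAbove : Sweep {n} upper [ y , q ⟩ q n [ 0 , q ⟩ [ 0 , q ⟩
  blockedAbove with m≤n⇒m<n∨m≡n q≤n
  ... | inj₂ refl = stay
  ... | inj₁ q<n = frozenAbove upper (≤-<-trans z≤n y<q) q<n
                 ▸ reject upper (extendTop z≤n) (ends-before-¬ICS y<q ≤-refl z≤n q<n)

sweepUpper-fillDown : ∀ {p q} → p < q → q < n → Sweep {n} upper [ p , n ⟩ 0 n [ p , q ⟩ [ 0 , suc q ⟩
sweepUpper-fillDown p<q q<n =
  frozenAbove upper p<q q<n
  ▸ accept upper (extendTop (<⇒≤ p<q)) (upper-behind ≤-refl q<n)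
  ▸ frozenInside upper p<q q<n
  ▸ reject upper (removeBottom (m<n⇒m<1+n p<q)) (starts-before-¬ICS (<-trans p<q q<n) (n<1+n _) p<q q<n)
  ▸ extendBottoms upper z≤n (m≤n⇒m≤1+n (<⇒≤ p<q)) (λ _ k<p → upper-behind (<⇒≤ k<p) q<n)

sweepLower-trim : ∀ {p q} → suc p < q → q ≤ n → Sweep {n} lower [ 0 , q ⟩ 0 n [ p , n ⟩ [ suc p , q ⟩
sweepLower-trim {q = suc v} (s≤s p<v) v<n =
  removeTops lower (m≤n⇒m≤1+n (<⇒≤ p<v)) v<n (λ v<k _ → upper-behind z≤n v<k)
  ▸ reject lower (removeTop (<⇒≤ p<v)) (ends-before-¬ICS p<v ≤-refl z≤n v<n)
  ▸ frozenInside lower p<v v<n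
  ▸ accept lower (removeBottom (m<n⇒m<1+n p<v)) (upper-behind z≤n ≤-refl)
  ▸ frozenBelow lower (s≤s p<v) v<n

sweepLower-fillUp : ∀ {p q} → suc p < q → q ≤ n → Sweep {n} lower [ suc p , q ⟩ 0 n ∅ [ suc p , n ⟩
sweepLower-fillUp {n} {q = suc v} (s≤s p<v) v<n =
  -- the empty lower interval is entered as [ n , n ⟩, which can then grow downwards
  Sweep-start-≗ (λ x → sym (∉ᵢ-empty n x))
    (extendBottoms lower (<-trans p<v v<n) ≤-refl (λ p<k _ → upper-behind p<k v<n)
    ▸ reject lower (extendBottom p<n) (starts-before-¬ICS p<n (n<1+n _) p<v v<n)
    ▸ frozenBelow lower (≤-trans (s≤s p<v) v<n) ≤-refl)
  where
  p<n = <-trans p<v v<n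

Row-by-sweeps : ∀ {L U L′ U′} → Sweep {n} upper L 0 n U U′ → Sweep {n} lower U′ 0 n L L′ →
  Row (shape L U) ≐ shape L′ U′
Row-by-sweeps {n} {L} {U} (mkSweep _ U↦U′) (mkSweep _ L↦L′) x =
  trans (Row≐sweeps (shape L U) x) (trans (sweepFrom-cong lower 0 n U↦U′ x) (L↦L′ x))

Row-shiftUpper : ∀ {b c} → b < c → c < n →
  Row (shape {n} ∅ [ b , c ⟩) ≐ shape [ suc b , n ⟩ [ suc b , suc c ⟩
Row-shiftUpper b<c c<n = Row-by-sweeps (sweep-shift upper b<c c<n) (sweepLower-fillUp (s≤s b<c) c<n)

Row-fill : ∀ {p q} → p < q → q < n →
  Row (shape {n} [ p , n ⟩ [ p , q ⟩) ≐ shape [ suc p , suc q ⟩ [ 0 , suc q ⟩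
Row-fill p<q q<n = Row-by-sweeps (sweepUpper-fillDown p<q q<n) (sweepLower-trim (s≤s p<q) q<n)

Row-complementBoth : ∀ {m} → m ≤ n → Row (shape {n} [ m , n ⟩ [ m , n ⟩) ≐ shape [ 0 , m ⟩ [ 0 , m ⟩
Row-complementBoth m≤n =
  Row-by-sweeps
    (sweep-complement upper m≤n (λ _ k<n → upper-behind ≤-refl (<⇒≤ k<n)) (λ _ → upper-below ≤-refl))
    (sweep-complement lower m≤n (λ _ _ → upper-below ≤-refl) (λ _ → upper-behind z≤n ≤-refl))

Row-complementUpper : ∀ {m} → m ≤ n → Row (shape {n} ∅ [ m , n ⟩) ≐ shape [ 0 , n ⟩ [ 0 , m ⟩
Row-complementUpper {n} m≤n =
  Row-by-sweeps
    (sweep-complement upper m≤n (λ _ _ → compatible-∅ upper) (λ _ → compatible-∅ upper))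
    (Sweep-start-≗ (λ x → sym (∉ᵢ-empty n x))
      (extendBottoms lower z≤n ≤-refl (λ _ _ → upper-behind z≤n m≤n)))

Row-shiftLower : ∀ {y q} → y < q → q < n →
  Row (shape {n} [ y , q ⟩ [ 0 , q ⟩) ≐ shape [ suc y , suc q ⟩ ∅
Row-shiftLower y<q q<n = Row-by-sweeps (sweepUpper-empty y<q (<⇒≤ q<n)) (sweep-shift lower y<q q<n)

Row-complementLower : ∀ {m} → m < n → Row (shape {n} [ m , n ⟩ [ 0 , n ⟩) ≐ shape [ 0 , m ⟩ ∅
Row-complementLower m<n =
  Row-by-sweeps (sweepUpper-empty m<n ≤-refl)
    (sweep-complement lower (<⇒≤ m<n) (λ _ _ → compatible-∅ lower) (λ _ → compatible-∅ lower))

-- The first three iterates of a High ICS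

highI≐shape : ∀ {b i c} → b + i ≡ c → highI {n} b i ≐ shape ∅ [ b , c ⟩
highI≐shape refl (lower , j) = refl
highI≐shape refl (upper , j) = refl

lowI≐shape : ∀ {x y} → lowI {n} x y ≐ shape [ x , x + y ⟩ ∅
lowI≐shape (lower , j) = refl
lowI≐shape (upper , j) = refl

≐-lowI : ∀ {S : Subset n} {l u x y} → S ≐ shape [ l , u ⟩ ∅ → l ≡ x → u ≡ x + y → S ≐ lowI x y
≐-lowI S≐ refl refl e = trans (S≐ e) (sym (lowI≐shape e))

point : ∀ {l u} → l < u → u ≤ n → ∃ λ (j : Fin n) → (toℕ j ∈ᵢ [ l , u ⟩) ≡ true
point {l = l} {u} l<u u≤n =
  fromℕ< l<n , ∈ᵢ-fromℕ< [ l , u ⟩ l<n (∈ᵢ-intro {l} {u} ≤-refl l<u)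
  where l<n = <-≤-trans l<u u≤n

Low-lowI : ∀ {x y} → 0 < y → x + y ≤ n → Low (lowI {n} x y)
Low-lowI {n} {x} {y} 0<y x+y≤n with j , j∈ ← point (m<m+n x 0<y) x+y≤n =
  trans (isICS-cong (lowI≐shape {n} {x} {y})) (shape-ICS {n} {[ x , x + y ⟩} {∅} (upper-empty z≤n)) ,
  ((lower , j) , j∈) , λ _ → refl

Low-resp : {S T : Subset n} → S ≐ T → Low T → Low S
Low-resp S≐T (ics , (x , Tx) , upperEmpty) =
  trans (isICS-cong S≐T) ics , (x , trans (S≐T x) Tx) , λ j → trans (S≐T (upper , j)) (upperEmpty j)

MeetsBothChains : Subset n → Set
MeetsBothChains {n} S =
  (∃ λ (j : Fin n) → S (lower , j) ≡ true) × (∃ λ (j : Fin n) → S (upper , j) ≡ true)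

meetsBoth-¬High : {S : Subset n} → MeetsBothChains S → ¬ High S
meetsBoth-¬High ((j , Sj) , _) (_ , _ , lowerEmpty) with () ← trans (sym Sj) (lowerEmpty j)

meetsBoth-¬Low : {S : Subset n} → MeetsBothChains S → ¬ Low S
meetsBoth-¬Low (_ , (j , Sj)) (_ , _ , upperEmpty) with () ← trans (sym Sj) (upperEmpty j)

meetsBoth : ∀ {S : Subset n} {l₁ l₂ u₁ u₂} → S ≐ shape [ l₁ , l₂ ⟩ [ u₁ , u₂ ⟩ →
  l₁ < l₂ → l₂ ≤ n → u₁ < u₂ → u₂ ≤ n → MeetsBothChains S
meetsBoth S≐ l₁<l₂ l₂≤n u₁<u₂ u₂≤n
  with j , j∈ ← point l₁<l₂ l₂≤n | k , k∈ ← point u₁<u₂ u₂≤n =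
  (j , trans (S≐ _) j∈) , (k , trans (S≐ _) k∈)

record Orbit {n : ℕ} (I : Subset n) (x y : ℕ) : Set where
  field
    first    : MeetsBothChains (Row I)
    second   : MeetsBothChains (Row (Row I))
    third    : Row (Row (Row I)) ≐ lowI x y
    nonempty : 0 < y
    fits     : x + y ≤ n

orbit-facts : ∀ {I : Subset n} {x y} {F : Set} → Orbit I x y → F →
  Low (Row (Row (Row I))) × ¬ High (Row I) × ¬ Low (Row I) × ¬ High (Row (Row I)) × ¬ Low (Row (Row I))
  × F
orbit-facts o f =
  Low-resp third (Low-lowI nonempty fits) ,
  meetsBoth-¬High first , meetsBoth-¬Low first , meetsBoth-¬High second , meetsBoth-¬Low second , f
  where open Orbit o

n∸i≡b+a : ∀ {b i a} → b + i + a ≡ n → n ∸ i ≡ b + a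
n∸i≡b+a {b = b} {i} {a} refl = trans (cong (_∸ i) (xy∙z≈xz∙y b i a)) (m+n∸n≡m (b + a) i)

Row-high : ∀ {b i} → 0 < i → b + i < n →
  Row (highI {n} b i) ≐ shape [ suc b , n ⟩ [ suc b , suc (b + i) ⟩
Row-high {b = b} 0<i c<n = Row-via (highI≐shape refl) (Row-shiftUpper (m<m+n b 0<i) c<n)

Row²-high : ∀ {b i} → 0 < i → suc (b + i) < n →
  Row (Row (highI {n} b i)) ≐ shape [ 2 + b , 2 + (b + i) ⟩ [ 0 , 2 + (b + i) ⟩
Row²-high {b = b} 0<i 1+c<n = Row-via (Row-high 0<i (<⇒≤ 1+c<n)) (Row-fill (s≤s (m<m+n b 0<i)) 1+c<n)

Row-highTop : ∀ {b i} → b + i ≡ n → Row (highI {n} b i) ≐ shape [ 0 , n ⟩ [ 0 , b ⟩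
Row-highTop {b = b} {i} b+i≡n =
  Row-via (highI≐shape b+i≡n) (Row-complementUpper (subst (b ≤_) b+i≡n (m≤m+n b i)))

Row²-highTop : ∀ {b i} → b + i ≡ n → 0 < b → 0 < i →
  Row (Row (highI {n} b i)) ≐ shape [ 1 , suc b ⟩ [ 0 , suc b ⟩
Row²-highTop {b = b} b+i≡n 0<b 0<i =
  Row-via (Row-highTop b+i≡n) (Row-fill 0<b (subst (b <_) b+i≡n (m<m+n b 0<i)))

orbit-a≥3 : ∀ {b i a} → b + i + a ≡ n → 0 < i → 3 ≤ a → Orbit (highI {n} b i) (b + 3) i
orbit-a≥3 {n} {b} {i} {a} b+i+a≡n 0<i 3≤a = record
  { first    = meetsBoth (Row-high 0<i c<n) (<-trans (s≤s b<c) 1+c<n) ≤-refl (s≤s b<c) c<n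
  ; second   = meetsBoth row² 2+b<2+c 1+c<n (s≤s z≤n) 1+c<n
  ; third    = ≐-lowI (Row-via row² (Row-shiftLower 2+b<2+c 2+c<n)) (+-comm 3 b) 3+c≡b+3+i
  ; nonempty = 0<i
  ; fits     = subst (_≤ n) 3+c≡b+3+i 2+c<n
  }
  where
  c = b + i
  b<c = m<m+n b 0<i
  2+b<2+c = s≤s (s≤s b<c)
  2+c<n : suc (suc c) < n
  2+c<n = subst (3 + c ≤_) b+i+a≡n (subst (_≤ c + a) (+-comm c 3) (+-monoʳ-≤ c 3≤a))
  1+c<n = <⇒≤ 2+c<n
  c<n = <⇒≤ 1+c<n
  row² = Row²-high 0<i 1+c<n
  3+c≡b+3+i : 3 + c ≡ b + 3 + i
  3+c≡b+3+i = trans (sym (+-assoc 3 b i)) (cong (_+ i) (+-comm 3 b))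

orbit-a≡2 : ∀ {b i} → b + i + 2 ≡ n → 0 < i → Orbit (highI {n} b i) 0 (n ∸ i)
orbit-a≡2 {n} {b} {i} b+i+2≡n 0<i = record
  { first    = meetsBoth (Row-high 0<i c<n) (<-trans (s≤s b<c) 1+c<n) ≤-refl (s≤s b<c) c<n
  ; second   = meetsBoth row² (s≤s (s≤s b<c)) 1+c<n (s≤s z≤n) 1+c<n
  ; third    = ≐-lowI (Row-via row²′ (Row-complementLower 2+b<n)) refl (sym n∸i≡2+b)
  ; nonempty = subst (0 <_) (sym n∸i≡2+b) (s≤s z≤n)
  ; fits     = m∸n≤m n i
  }
  where
  c = b + i
  b<c = m<m+n b 0<i
  2+c≡n : 2 + c ≡ n
  2+c≡n = trans (+-comm 2 c) b+i+2≡n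
  1+c<n = ≤-reflexive 2+c≡n
  c<n = <⇒≤ 1+c<n
  2+b<n : 2 + b < n
  2+b<n = subst (2 + b <_) 2+c≡n (s≤s (s≤s b<c))
  row² = Row²-high 0<i 1+c<n
  row²′ : Row (Row (highI {n} b i)) ≐ shape [ 2 + b , n ⟩ [ 0 , n ⟩
  row²′ = subst (λ t → Row (Row (highI {n} b i)) ≐ shape [ 2 + b , t ⟩ [ 0 , t ⟩) 2+c≡n row²
  n∸i≡2+b : n ∸ i ≡ 2 + b
  n∸i≡2+b = trans (n∸i≡b+a {b = b} {i} b+i+2≡n) (+-comm b 2)

orbit-a≡1 : ∀ {b i} → b + i + 1 ≡ n → 0 < i → Orbit (highI {n} b i) 1 (n ∸ i)
orbit-a≡1 {n} {b} {i} b+i+1≡n 0<i = record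
  { first    = meetsBoth row¹ 1+b<n ≤-refl (s≤s b<c) c<n
  ; second   = meetsBoth row² (s≤s z≤n) 1+b≤n (s≤s z≤n) 1+b≤n
  ; third    = ≐-lowI (Row-via row² (Row-shiftLower (s≤s z≤n) 1+b<n)) refl (cong suc (sym n∸i≡1+b))
  ; nonempty = subst (0 <_) (sym n∸i≡1+b) (s≤s z≤n)
  ; fits     = subst (_≤ n) (cong suc (sym n∸i≡1+b)) 1+b<n
  }
  where
  c = b + i
  b<c = m<m+n b 0<i
  1+c≡n : suc c ≡ n
  1+c≡n = trans (+-comm 1 c) b+i+1≡n
  c<n = ≤-reflexive 1+c≡n
  1+b<n = <-≤-trans (s≤s b<c) c<n
  1+b≤n = <⇒≤ 1+b<n
  row¹ = Row-high 0<i c<n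
  row² : Row (Row (highI {n} b i)) ≐ shape [ 0 , suc b ⟩ [ 0 , suc b ⟩
  row² = Row-via (subst (λ t → Row (highI {n} b i) ≐ shape [ suc b , n ⟩ [ suc b , t ⟩) 1+c≡n row¹)
                   (Row-complementBoth 1+b≤n)
  n∸i≡1+b : n ∸ i ≡ suc b
  n∸i≡1+b = trans (n∸i≡b+a {b = b} {i} b+i+1≡n) (+-comm b 1)

orbit-a≡0 : ∀ {b i} → b + i + 0 ≡ n → 1 < i → i ≢ n → Orbit (highI {n} b i) 2 (n ∸ i)
orbit-a≡0 {n} {b} {i} b+i+0≡n 1<i i≢n = record
  { first    = meetsBoth (Row-highTop b+i≡n) (<-trans 0<b b<n) ≤-refl 0<b (<⇒≤ b<n)
  ; second   = meetsBoth row² (s≤s 0<b) (<⇒≤ 1+b<n) (s≤s z≤n) (<⇒≤ 1+b<n)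
  ; third    = ≐-lowI (Row-via row² (Row-shiftLower (s≤s 0<b) 1+b<n)) refl (cong (2 +_) (sym n∸i≡b))
  ; nonempty = subst (0 <_) (sym n∸i≡b) 0<b
  ; fits     = subst (λ t → 2 + t ≤ n) (sym n∸i≡b) 1+b<n
  }
  where
  b+i≡n = trans (sym (+-identityʳ (b + i))) b+i+0≡n
  0<b : 0 < b
  0<b = n≢0⇒n>0 (λ { refl → i≢n b+i≡n })
  b<n = subst (b <_) b+i≡n (m<m+n b (<-trans (s≤s z≤n) 1<i))
  1+b<n : suc b < n
  1+b<n = subst₂ _<_ (+-comm b 1) b+i≡n (+-monoʳ-< b 1<i)
  row² = Row²-highTop b+i≡n 0<b (<-trans (s≤s z≤n) 1<i)
  n∸i≡b : n ∸ i ≡ b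
  n∸i≡b = trans (n∸i≡b+a {b = b} {i} b+i+0≡n) (+-identityʳ b)

orbit-i≡1 : ∀ {b} → b + 1 + 0 ≡ n → 1 ≢ n → Orbit (highI {n} b 1) 0 1
orbit-i≡1 {n} {b} b+1+0≡n 1≢n = record
  { first    = meetsBoth (Row-highTop b+1≡n) (<-trans 0<b b<n) ≤-refl 0<b (<⇒≤ b<n)
  ; second   = meetsBoth row² (s≤s 0<b) 1+b≤n (s≤s z≤n) 1+b≤n
  ; third    = ≐-lowI (Row-via row²′ (Row-complementLower 1<n)) refl refl
  ; nonempty = s≤s z≤n
  ; fits     = <⇒≤ 1<n
  }
  where
  b+1≡n = trans (sym (+-identityʳ (b + 1))) b+1+0≡n
  1+b≡n : suc b ≡ n
  1+b≡n = trans (+-comm 1 b) b+1≡n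
  0<b : 0 < b
  0<b = n≢0⇒n>0 (λ { refl → 1≢n b+1≡n })
  1+b≤n = ≤-reflexive 1+b≡n
  b<n = 1+b≤n
  1<n = <-≤-trans (s≤s 0<b) 1+b≤n
  row² = Row²-highTop b+1≡n 0<b (s≤s z≤n)
  row²′ : Row (Row (highI {n} b 1)) ≐ shape [ 1 , n ⟩ [ 0 , n ⟩
  row²′ = subst (λ t → Row (Row (highI {n} b 1)) ≐ shape [ 1 , t ⟩ [ 0 , t ⟩) 1+b≡n row²

proposition3p21 : ∀ (n b i a : ℕ) → b + i + a ≡ n → 1 ≤ i → i ≢ n →
    let I = highI {n} b i in
    Low (Row (Row (Row I)))
    × (¬ High (Row I)) × (¬ Low (Row I))
    × (¬ High (Row (Row I))) × (¬ Low (Row (Row I)))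
    × (3 ≤ a → Row (Row (Row I)) ≐ lowI (b + 3) i)
    × (0 < a → a < 3 → Row (Row (Row I)) ≐ lowI (2 ∸ a) (n ∸ i))
    × (a ≡ 0 → 1 < i → Row (Row (Row I)) ≐ lowI 2 (n ∸ i))
    × (a ≡ 0 → i ≡ 1 → Row (Row (Row I)) ≐ lowI 0 1)
proposition3p21 n b 0 0 _ () _
proposition3p21 n b 1 0 e _ 1≢n =
  orbit-facts o ((λ ()) , (λ ()) , (λ { _ (s≤s ()) }) , (λ _ _ → Orbit.third o))
  where o = orbit-i≡1 e 1≢n
proposition3p21 n b (suc (suc i)) 0 e _ i≢n =
  orbit-facts o ((λ ()) , (λ ()) , (λ _ _ → Orbit.third o) , (λ { _ () }))
  where o = orbit-a≡0 e (s≤s (s≤s z≤n)) i≢n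
proposition3p21 n b i 1 e 0<i _ =
  orbit-facts o ((λ { (s≤s ()) }) , (λ _ _ → Orbit.third o) , (λ ()) , (λ ()))
  where o = orbit-a≡1 e 0<i
proposition3p21 n b i 2 e 0<i _ =
  orbit-facts o ((λ { (s≤s (s≤s ())) }) , (λ _ _ → Orbit.third o) , (λ ()) , (λ ()))
  where o = orbit-a≡2 e 0<i
proposition3p21 n b i (suc (suc (suc a))) e 0<i _ =
  orbit-facts o ((λ _ → Orbit.third o) , (λ { _ (s≤s (s≤s (s≤s ()))) }) , (λ ()) , (λ ()))
  where o = orbit-a≥3 e 0<i (s≤s (s≤s (s≤s z≤n)))
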